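{- A finite lattice $L$ is semidistributive if and only if it is meet-semidistributive and the rowmotion operator $\mathsf{Row}_L:L\to L$ is bijective.
   Context: All lattices are finite. $L$ is join-semidistributive if $x\vee y=x\vee z$ implies $x\vee(y\wedge z)=x\vee y$, meet-semidistributive if $x\wedge y=x\wedge z$ implies $x\wedge(y\vee z)=x\wedge y$, and semidistributive if both. The pop-stack sorting operator is $\mathsf{Pop}^\downarrow_L(x)=x\wedge\bigwedge\{y\in L:y\lessdot x\}$. In a meet-semidistributive lattice, for $a\le b$ the set $\{z\in L: a=b\wedge z\}$ has a unique maximal element; rowmotion on a meet-semidistributive lattice $L$ is the map $\mathsf{Row}_L:L\to L$ sending $x$ to the unique maximal element of $\{z\in L:\mathsf{Pop}^\downarrow_L(x)=x\wedge z\}$. -}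

module Defs where

open import Level using (0ℓ)
open import Algebra.Lattice.Bundles using (Lattice)
open import Data.List using (List)
open import Data.List.Relation.Unary.Any using (Any)
open import Data.Product using (Σ; _×_; ∃)
open import Relation.Nullary using (¬_)
open import Data.Empty using (⊥)
open import Relation.Binary using (Decidable)
open import Function.Bundles using (_⇔_)

-- A finite lattice: an (algebraic) lattice whose carrier is finitely
-- enumerated (every element is ≈ to an entry of the list 'elems'),
-- with decidable equality (automatic for finite sets classically).
record FiniteLattice : Set₁ where
  field
    lattice  : Lattice 0ℓ 0ℓ
  open Lattice lattice public
  field
    _≟_      : Decidable _≈_
    elems    : List Carrier
    complete : ∀ x → Any (x ≈_) elems

module _ (L : FiniteLattice) where
  open FiniteLattice L

  _≤_ : Carrier → Carrier → Set
  x ≤ y = (x ∧ y) ≈ x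

  _<_ : Carrier → Carrier → Set
  x < y = x ≤ y × ¬ (x ≈ y)

  _⋖_ : Carrier → Carrier → Set
  y ⋖ x = y < x × (∀ z → y < z → z < x → ⊥)

  JoinSemidistributive : Set
  JoinSemidistributive = ∀ x y z → (x ∨ y) ≈ (x ∨ z) → (x ∨ (y ∧ z)) ≈ (x ∨ y)

  MeetSemidistributive : Set
  MeetSemidistributive = ∀ x y z → (x ∧ y) ≈ (x ∧ z) → (x ∧ (y ∨ z)) ≈ (x ∧ y)

  Semidistributive : Set
  Semidistributive = JoinSemidistributive × MeetSemidistributive

  IsPop : Carrier → Carrier → Set
  IsPop x p = (p ≤ x × (∀ y → y ⋖ x → p ≤ y))
            × (∀ q → q ≤ x → (∀ y → y ⋖ x → q ≤ y) → q ≤ p)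

  IsRow : Carrier → Carrier → Set
  IsRow x r = Σ Carrier λ p → IsPop x p
            × (p ≈ (x ∧ r))
            × (∀ z → p ≈ (x ∧ z) → r ≤ z → z ≈ r)

  -- Row_L is a well-defined map L → L (each x has exactly one Row-value,
  -- up to ≈) and this map is bijective (injective and surjective).
  RowBijective : Set
  RowBijective =
      (∀ x → Σ Carrier λ r → IsRow x r × (∀ r' → IsRow x r' → r' ≈ r))
    × (∀ x x' r → IsRow x r → IsRow x' r → x ≈ x')
    × (∀ r → Σ Carrier λ x → IsRow x r)

-- In a join-semidistributive lattice every
-- lower cover y ⋖ x has a label j, the least element below x and not below y; meet-semidistributivity
-- gives j ≰ r ∨ y and j ≤ u for every upper cover u ≤ r ∨ j of r.  Hence r ∨ x is r joined with its
-- upper covers, and no z < x has r ∨ z = r ∨ x; if Row x = Row x′ = r then r ∨ (x ∧ x′) = r ∨ x by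
-- join-semidistributivity, so x ≤ x′.  Rowmotion of the dual lattice inverts Row.
-- Conversely, if x ∨ y = x ∨ z = w but x ∨ (y ∧ z) < w, take m maximal above x ∨ (y ∧ z) and not
-- above w: the minimal a ≤ y and a′ ≤ z with w ≤ m ∨ a, m ∨ a′ are both sent to m by Row, so a = a′ ≤ y ∧ z ≤ m.
module Submission where

open import Defs hiding (_≤_; _<_; _⋖_)
open import Level using (0ℓ)
open import Data.Empty using (⊥; ⊥-elim)
open import Data.Fin using (Fin)
open import Data.Fin.Induction using (po-noetherian)
open import Data.List using (List; []; _∷_; lookup)
open import Data.List.Relation.Unary.Any as Any using (Any; here; there; any?; index; satisfied)
open import Data.List.Relation.Unary.Any.Properties using (lookup-index)
open import Data.Product using (∃; _×_; _,_; proj₁; proj₂; map₂)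
open import Function using (flip; case_of_)
open import Function.Bundles using (_⇔_; mk⇔)
open import Induction.WellFounded using (WellFounded; Acc; acc; module Subrelation)
import Algebra.Lattice.Properties.Lattice as LatticeProperties
open import Relation.Binary using (Rel; IsPartialOrder; Decidable; _Respects_)
import Relation.Binary.Construct.Flip.EqAndOrd as Flip
import Relation.Binary.Construct.NonStrictToStrict as ToStrict
import Relation.Binary.Construct.On as On
import Relation.Binary.Lattice.Bundles as OrderTheoretic
import Relation.Binary.Lattice.Properties.JoinSemilattice as JoinSemilatticeProperties
import Relation.Binary.Reasoning.Setoid as SetoidReasoning
open import Relation.Nullary using (¬_; Dec; yes; no)
open import Relation.Nullary.Decidable using (_×-dec_; ¬?; decidable-stable)
open import Relation.Unary as U using (Pred)

module FinitePoset {a ℓ₁ ℓ₂} {A : Set a} {_≈_ : Rel A ℓ₁} {_≤_ : Rel A ℓ₂}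
  (isPartialOrder : IsPartialOrder _≈_ _≤_) (_≟_ : Decidable _≈_) (_≤?_ : Decidable _≤_)
  {xs : List A} (enumerates : ∀ x → Any (x ≈_) xs) where

  open IsPartialOrder isPartialOrder
  open ToStrict _≈_ _≤_ using (_<_)

  private
    <-respʳ : ∀ {x y z} → y ≈ z → x < y → x < z
    <-respʳ = ToStrict.<-respʳ-≈ _≈_ _≤_ Eq.sym Eq.trans ≲-respʳ-≈

    <-respˡ : ∀ {x y z} → y ≈ z → y < x → z < x
    <-respˡ = ToStrict.<-respˡ-≈ _≈_ _≤_ Eq.trans ≲-respˡ-≈

    _<?_ : Decidable _<_
    _<?_ = ToStrict.<-decidable _≈_ _≤_ _≟_ _≤?_

  ∃? : ∀ {p} {P : Pred A p} → P Respects _≈_ → U.Decidable P → Dec (∃ P)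
  ∃? resp P? with any? P? xs
  ... | yes any = yes (satisfied any)
  ... | no none = no λ (x , px) → none (Any.map (λ x≈y → resp x≈y px) (enumerates x))

  >-wellFounded : WellFounded (flip _<_)
  >-wellFounded = Subrelation.wellFounded <-at-positions
    (On.wellFounded position (po-noetherian (On.isPartialOrder (lookup xs) isPartialOrder)))
    where
    position : A → Fin _
    position x = index (enumerates x)

    at-position : ∀ x → x ≈ lookup xs (position x)
    at-position x = lookup-index (enumerates x)

    <-at-positions : ∀ {x y} → y < x → lookup xs (position y) < lookup xs (position x)
    <-at-positions {x} {y} y<x = <-respʳ (at-position x) (<-respˡ (at-position y) y<x)

  maximal-above : ∀ {p} {P : Pred A p} → P Respects _≈_ → U.Decidable P →
                  ∀ {c} → P c → ∃ λ m → c ≤ m × P m × (∀ z → P z → m ≤ z → z ≈ m)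
  maximal-above {P = P} resp P? pc = go (>-wellFounded _) pc
    where
    go : ∀ {c} → Acc (flip _<_) c → P c → ∃ λ m → c ≤ m × P m × (∀ z → P z → m ≤ z → z ≈ m)
    go {c} (acc above) pc with ∃? (λ e≈e′ (pe , c<e) → resp e≈e′ pe , <-respʳ e≈e′ c<e) (λ e → P? e ×-dec c <? e)
    ... | yes (e , pe , c<e) = case go (above c<e) pe of λ (m , e≤m , pm , maximal) →
      m , trans (proj₁ c<e) e≤m , pm , maximal
    ... | no nothing-above = c , refl , pc , λ z pz c≤z → decidable-stable (z ≟ c) λ z≉c →
      nothing-above (z , pz , c≤z , λ c≈z → z≉c (Eq.sym c≈z))

module Order (L : FiniteLattice) where
  open FiniteLattice L
  open LatticeProperties lattice using (∨-∧-orderTheoreticLattice)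
  private module O = OrderTheoretic.Lattice ∨-∧-orderTheoreticLattice

  infix 4 _≤_ _<_ _⋖_ _≤?_ _<?_ _⋖?_

  _≤_ : Rel Carrier 0ℓ
  _≤_ = Defs._≤_ L

  _<_ : Rel Carrier 0ℓ
  _<_ = Defs._<_ L

  _⋖_ : Rel Carrier 0ℓ
  _⋖_ = Defs._⋖_ L

  -- The library orders a lattice by x ≈ x ∧ y, Defs by x ∧ y ≈ x.
  ≤-isPartialOrder : IsPartialOrder _≈_ _≤_
  ≤-isPartialOrder = record
    { isPreorder = record
      { isEquivalence = isEquivalence
      ; reflexive     = λ x≈y → sym (O.reflexive x≈y)
      ; trans         = λ x≤y y≤z → sym (O.trans (sym x≤y) (sym y≤z))
      }
    ; antisym = λ x≤y y≤x → O.antisym (sym x≤y) (sym y≤x)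
    }

  open IsPartialOrder ≤-isPartialOrder public using () renaming
    (refl to ≤-refl; reflexive to ≤-reflexive; trans to ≤-trans; antisym to ≤-antisym;
     ≲-respˡ-≈ to ≤-respˡ-≈; ≲-respʳ-≈ to ≤-respʳ-≈)

  _≤?_ : Decidable _≤_
  x ≤? y = (x ∧ y) ≟ x

  _<?_ : Decidable _<_
  _<?_ = ToStrict.<-decidable _≈_ _≤_ _≟_ _≤?_

  x∧y≤x : ∀ {x y} → x ∧ y ≤ x
  x∧y≤x = sym (O.x∧y≤x _ _)

  x∧y≤y : ∀ {x y} → x ∧ y ≤ y
  x∧y≤y = sym (O.x∧y≤y _ _)

  ∧-greatest : ∀ {x y z} → x ≤ y → x ≤ z → x ≤ y ∧ z
  ∧-greatest x≤y x≤z = sym (O.∧-greatest (sym x≤y) (sym x≤z))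

  x≤x∨y : ∀ {x y} → x ≤ x ∨ y
  x≤x∨y = sym (O.x≤x∨y _ _)

  y≤x∨y : ∀ {x y} → y ≤ x ∨ y
  y≤x∨y = sym (O.y≤x∨y _ _)

  ∨-least : ∀ {x y z} → x ≤ z → y ≤ z → x ∨ y ≤ z
  ∨-least x≤z y≤z = sym (O.∨-least (sym x≤z) (sym y≤z))

  x≤y⇒y∨x≈y : ∀ {x y} → x ≤ y → y ∨ x ≈ y
  x≤y⇒y∨x≈y x≤y = trans (∨-comm _ _) (JoinSemilatticeProperties.x≤y⇒x∨y≈y O.joinSemilattice (sym x≤y))

  x≈y∧z⇒x≤z : ∀ {x y z} → x ≈ y ∧ z → x ≤ z
  x≈y∧z⇒x≤z x≈y∧z = ≤-respˡ-≈ (sym x≈y∧z) x∧y≤y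

  ∨-monotonicʳ : ∀ {x y z} → x ≤ y → z ∨ x ≤ z ∨ y
  ∨-monotonicʳ x≤y = ∨-least x≤x∨y (≤-trans x≤y y≤x∨y)

  ∧-monotonicˡ : ∀ {x y z} → x ≤ y → x ∧ z ≤ y ∧ z
  ∧-monotonicˡ x≤y = ∧-greatest (≤-trans x∧y≤x x≤y) x∧y≤y

  open FinitePoset ≤-isPartialOrder _≟_ _≤?_ complete public using (∃?; maximal-above)
  open FinitePoset (Flip.isPartialOrder ≤-isPartialOrder) _≟_ (flip _≤?_) complete public
    using () renaming (maximal-above to minimal-below)

  <-respˡ-≈ : ∀ {x y z} → x ≈ y → x < z → y < z
  <-respˡ-≈ = ToStrict.<-respˡ-≈ _≈_ _≤_ trans ≤-respˡ-≈

  <-respʳ-≈ : ∀ {x y z} → y ≈ z → x < y → x < z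
  <-respʳ-≈ = ToStrict.<-respʳ-≈ _≈_ _≤_ sym trans ≤-respʳ-≈

  ⋖⇒≱ : ∀ {x y} → y ⋖ x → ¬ x ≤ y
  ⋖⇒≱ ((y≤x , y≉x) , _) x≤y = y≉x (≤-antisym y≤x x≤y)

  ⋖-squeeze : ∀ {x y z} → y ⋖ x → y ≤ z → z ≤ x → ¬ z ≈ y → z ≈ x
  ⋖-squeeze {x} {z = z} (_ , nothing-between) y≤z z≤x z≉y = decidable-stable (z ≟ x) λ z≉x →
    nothing-between _ (y≤z , λ y≈z → z≉y (sym y≈z)) (z≤x , z≉x)

  ⋖-join : ∀ {x y v} → y ⋖ x → v ≤ x → ¬ v ≤ y → y ∨ v ≈ x
  ⋖-join y⋖x v≤x v≰y = ⋖-squeeze y⋖x x≤x∨y (∨-least (y⋖x .proj₁ .proj₁) v≤x)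
    λ y∨v≈y → v≰y (≤-respʳ-≈ y∨v≈y y≤x∨y)

  lowerCover-above : ∀ {x z} → z < x → ∃ λ y → y ⋖ x × z ≤ y
  lowerCover-above z<x with maximal-above <-respˡ-≈ (_<? _) z<x
  ... | y , z≤y , y<x , maximal = y , (y<x , λ w y<w w<x → y<w .proj₂ (sym (maximal w w<x (y<w .proj₁)))) , z≤y

  upperCover-below : ∀ {x z} → x < z → ∃ λ u → x ⋖ u × u ≤ z
  upperCover-below x<z with minimal-below <-respʳ-≈ (_ <?_) x<z
  ... | u , u≤z , x<u , minimal = u , (x<u , λ w x<w w<u → w<u .proj₂ (minimal w x<w (w<u .proj₁))) , u≤z

  _⋖?_ : Decidable _⋖_
  y ⋖? x with y <? x
  ... | no y≮x = no λ y⋖x → y≮x (y⋖x .proj₁)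
  ... | yes y<x with ∃? (λ w≈w′ (y<w , w<x) → <-respʳ-≈ w≈w′ y<w , <-respˡ-≈ w≈w′ w<x) (λ w → (y <? w) ×-dec (w <? x))
  ...   | yes (w , y<w , w<x) = no λ y⋖x → y⋖x .proj₂ w y<w w<x
  ...   | no nothing-between = yes (y<x , λ w y<w w<x → nothing-between (w , y<w , w<x))

  ⋖-respˡ-≈ : ∀ {x y y′} → y ≈ y′ → y ⋖ x → y′ ⋖ x
  ⋖-respˡ-≈ y≈y′ (y<x , nothing-between) =
    <-respˡ-≈ y≈y′ y<x , λ w y′<w w<x → nothing-between w (<-respˡ-≈ (sym y≈y′) y′<w) w<x

  -- For join-semidistributive L this is the join-irreducible labelling the cover y ⋖ x.
  IsLabel : Carrier → Carrier → Carrier → Set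
  IsLabel y x j = j ≤ x × ¬ j ≤ y × (∀ v → v ≤ x → ¬ v ≤ y → j ≤ v)

  label-exists : JoinSemidistributive L → ∀ {x y} → y ⋖ x → ∃ (IsLabel y x)
  label-exists jsd {x} {y} y⋖x
    with minimal-below (λ j≈j′ (j≤x , j≰y) → ≤-respˡ-≈ j≈j′ j≤x , λ j′≤y → j≰y (≤-respˡ-≈ (sym j≈j′) j′≤y))
                       (λ j → (j ≤? x) ×-dec ¬? (j ≤? y)) (≤-refl , ⋖⇒≱ y⋖x)
  ... | j , _ , (j≤x , j≰y) , minimal = j , j≤x , j≰y , least
    where
    least : ∀ v → v ≤ x → ¬ v ≤ y → j ≤ v
    least v v≤x v≰y = decidable-stable (j ≤? v) λ j≰v →
      ⋖⇒≱ y⋖x (≤-reflexive (trans (sym y∨[j∧v]≈x) (x≤y⇒y∨x≈y (j∧v≤y j≰v))))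
      where
      j∧v≤y : ¬ j ≤ v → j ∧ v ≤ y
      j∧v≤y j≰v = decidable-stable (j ∧ v ≤? y) λ j∧v≰y →
        j≰v (≤-respˡ-≈ (minimal (j ∧ v) (≤-trans x∧y≤x j≤x , j∧v≰y) x∧y≤x) x∧y≤y)
      y∨[j∧v]≈x : y ∨ (j ∧ v) ≈ x
      y∨[j∧v]≈x = trans (jsd y j v (trans (⋖-join y⋖x j≤x j≰y) (sym (⋖-join y⋖x v≤x v≰y)))) (⋖-join y⋖x j≤x j≰y)

  label≤ : ∀ {x y j v} → IsLabel y x j → ¬ x ∧ v ≤ y → j ≤ v
  label≤ (_ , _ , least) x∧v≰y = ≤-trans (least _ x∧y≤x x∧v≰y) x∧y≤y

  label≤otherLowerCover : ∀ {x y y′ j} → y ⋖ x → IsLabel y x j → y′ ⋖ x → ¬ y′ ≈ y → j ≤ y′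
  label≤otherLowerCover y⋖x (_ , _ , least) y′⋖x y′≉y =
    least _ (y′⋖x .proj₁ .proj₁)
      λ y′≤y → ⋖⇒≱ y⋖x (≤-reflexive (sym (⋖-squeeze y′⋖x y′≤y (y⋖x .proj₁ .proj₁) λ y≈y′ → y′≉y (sym y≈y′))))

  meetSemidistributive-cancel : MeetSemidistributive L → ∀ {j r y} → j ∧ r ≈ j ∧ y → j ≤ r ∨ y → j ≤ y
  meetSemidistributive-cancel msd {j} {r} {y} j∧r≈j∧y j≤r∨y = begin
    j ∧ y        ≈⟨ j∧r≈j∧y ⟨
    j ∧ r        ≈⟨ msd j r y j∧r≈j∧y ⟨
    j ∧ (r ∨ y)  ≈⟨ j≤r∨y ⟩
    j            ∎
    where open SetoidReasoning setoid

module Pop (L : FiniteLattice) where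
  open FiniteLattice L
  open Order L

  meet-below : ∀ {p} {S : Pred Carrier p} → S Respects _≈_ → U.Decidable S → ∀ x →
               ∃ λ g → (g ≤ x × (∀ y → S y → g ≤ y)) × (∀ q → q ≤ x → (∀ y → S y → q ≤ y) → q ≤ g)
  meet-below {S = S} S-resp S? x =
    case go elems of λ (g , g≤x , g≤S , greatest) → g , (g≤x , λ y Sy → g≤S (complete y) Sy) , greatest
    where
    go : ∀ ys → ∃ λ g → g ≤ x × (∀ {y} → Any (y ≈_) ys → S y → g ≤ y)
                        × (∀ q → q ≤ x → (∀ y → S y → q ≤ y) → q ≤ g)
    go [] = x , ≤-refl , (λ ()) , λ _ q≤x _ → q≤x
    go (e ∷ es) with go es | S? e
    ... | g , g≤x , g≤S , greatest | yes Se =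
      e ∧ g , ≤-trans x∧y≤y g≤x ,
      (λ { (here y≈e) _ → ≤-respʳ-≈ (sym y≈e) x∧y≤x ; (there y∈es) Sy → ≤-trans x∧y≤y (g≤S y∈es Sy) }) ,
      λ q q≤x q≤S → ∧-greatest (q≤S e Se) (greatest q q≤x q≤S)
    ... | g , g≤x , g≤S , greatest | no ¬Se =
      g , g≤x , (λ { (here y≈e) Sy → ⊥-elim (¬Se (S-resp y≈e Sy)) ; (there y∈es) Sy → g≤S y∈es Sy }) , greatest

  pop-exists : ∀ x → ∃ (IsPop L x)
  pop-exists x = meet-below ⋖-respˡ-≈ (_⋖? x) x

  pop-unique : ∀ {x p p′} → IsPop L x p → IsPop L x p′ → p ≈ p′
  pop-unique ((p≤x , p≤covers) , p-greatest) ((p′≤x , p′≤covers) , p′-greatest) =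
    ≤-antisym (p′-greatest _ p≤x p≤covers) (p-greatest _ p′≤x p′≤covers)

  row-exists : ∀ x → ∃ (IsRow L x)
  row-exists x with pop-exists x
  ... | p , pop@((p≤x , _) , _)
    with maximal-above (λ z≈z′ p≈x∧z → trans p≈x∧z (∧-cong refl z≈z′)) (λ z → p ≟ (x ∧ z))
                       (sym (trans (∧-comm x p) p≤x))
  ...   | r , _ , p≈x∧r , maximal = r , p , pop , p≈x∧r , maximal

  row-unique : MeetSemidistributive L → ∀ {x r r′} → IsRow L x r → IsRow L x r′ → r′ ≈ r
  row-unique msd {x} {r} {r′} (p , pop , p≈x∧r , r-maximal) (p′ , pop′ , p′≈x∧r′ , r′-maximal) =
    trans (sym (r′-maximal (r ∨ r′) p′≈x∧[r∨r′] y≤x∨y)) (r-maximal (r ∨ r′) p≈x∧[r∨r′] x≤x∨y)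
    where
    p≈x∧[r∨r′] : p ≈ x ∧ (r ∨ r′)
    p≈x∧[r∨r′] = trans p≈x∧r (sym (msd x r r′ (trans (sym p≈x∧r) (trans (pop-unique pop pop′) p′≈x∧r′))))
    p′≈x∧[r∨r′] : p′ ≈ x ∧ (r ∨ r′)
    p′≈x∧[r∨r′] = trans (pop-unique pop′ pop) p≈x∧[r∨r′]

  row-upperCover≤ : ∀ {x r u} → IsRow L x r → r ⋖ u → u ≤ r ∨ x
  row-upperCover≤ {x} {r} {u} (p , ((p≤x , _) , _) , p≈x∧r , maximal) r⋖u@((r≤u , r≉u) , _) =
    ≤-respˡ-≈ (⋖-join r⋖u x∧y≤y x∧u≰r) (∨-least x≤x∨y (≤-trans x∧y≤x y≤x∨y))
    where
    x∧u≰r : ¬ x ∧ u ≤ r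
    x∧u≰r x∧u≤r = r≉u (sym (maximal u p≈x∧u r≤u))
      where
      p≈x∧u : p ≈ x ∧ u
      p≈x∧u = ≤-antisym (∧-greatest p≤x (≤-trans (x≈y∧z⇒x≤z p≈x∧r) r≤u))
                        (≤-respʳ-≈ (sym p≈x∧r) (∧-greatest x∧y≤x x∧u≤r))

  label-meet : ∀ {x p r y j} → IsPop L x p → p ≈ x ∧ r → y ⋖ x → IsLabel y x j → j ∧ r ≈ j ∧ y
  label-meet {x} {p} {r} {y} {j} ((_ , p≤lowerCovers) , p-greatest) p≈x∧r y⋖x label@(j≤x , _) =
    ≤-antisym (∧-greatest x∧y≤x (≤-trans (≤-trans (∧-monotonicˡ j≤x) x∧r≤p) (p≤lowerCovers y y⋖x)))
              (∧-greatest x∧y≤x (≤-trans j∧y≤p (x≈y∧z⇒x≤z p≈x∧r)))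
    where
    x∧r≤p : x ∧ r ≤ p
    x∧r≤p = ≤-reflexive (sym p≈x∧r)
    j∧y≤p : j ∧ y ≤ p
    j∧y≤p = p-greatest (j ∧ y) (≤-trans x∧y≤x j≤x) j∧y≤lowerCover
      where
      j∧y≤lowerCover : ∀ y′ → y′ ⋖ x → j ∧ y ≤ y′
      j∧y≤lowerCover y′ y′⋖x with y′ ≟ y
      ... | yes y′≈y = ≤-respʳ-≈ (sym y′≈y) x∧y≤y
      ... | no y′≉y = ≤-trans x∧y≤x (label≤otherLowerCover y⋖x label y′⋖x y′≉y)

module Converse (L : FiniteLattice) where
  open FiniteLattice L
  open Order L
  open Pop L

  ∧-isPop : ∀ {a m} → ¬ a ≤ m → (∀ s → s < a → s ≤ m) → IsPop L a (a ∧ m)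
  ∧-isPop {a} {m} a≰m <a⇒≤m = (x∧y≤x , a∧m≤lowerCover) , greatest
    where
    a∧m<a : a ∧ m < a
    a∧m<a = x∧y≤x , λ a∧m≈a → a≰m (≤-respˡ-≈ a∧m≈a x∧y≤y)
    lowerCover≤a∧m : ∀ {y} → y ⋖ a → y ≤ a ∧ m
    lowerCover≤a∧m y⋖a = ∧-greatest (y⋖a .proj₁ .proj₁) (<a⇒≤m _ (y⋖a .proj₁))
    a∧m≤lowerCover : ∀ y → y ⋖ a → a ∧ m ≤ y
    a∧m≤lowerCover y y⋖a = ≤-reflexive (decidable-stable ((a ∧ m) ≟ y) λ a∧m≉y →
      a∧m<a .proj₂ (⋖-squeeze y⋖a (lowerCover≤a∧m y⋖a) x∧y≤x a∧m≉y))
    greatest : ∀ q → q ≤ a → (∀ y → y ⋖ a → q ≤ y) → q ≤ a ∧ m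
    greatest q _ q≤lowerCovers with lowerCover-above a∧m<a
    ... | y , y⋖a , _ = ≤-trans (q≤lowerCovers y y⋖a) (lowerCover≤a∧m y⋖a)

  module _ {w m} (w≰m : ¬ w ≤ m) (m-maximal : ∀ v → ¬ w ≤ v → m ≤ v → v ≈ m) where

    ≤-unless-≤∨ : ∀ {v} → ¬ w ≤ m ∨ v → v ≤ m
    ≤-unless-≤∨ {v} w≰m∨v = ≤-respʳ-≈ (m-maximal (m ∨ v) w≰m∨v x≤x∨y) y≤x∨y

    rowPreimage-below : ∀ {b} → b ≤ w → w ≤ m ∨ b → ∃ λ a → a ≤ b × w ≤ m ∨ a × IsRow L a m
    rowPreimage-below {b} b≤w w≤m∨b
      with minimal-below (λ s≈s′ w≤m∨s → ≤-respʳ-≈ (∨-cong refl s≈s′) w≤m∨s) (λ s → w ≤? m ∨ s) w≤m∨b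
    ... | a , a≤b , w≤m∨a , minimal = a , a≤b , w≤m∨a , a ∧ m , ∧-isPop a≰m <a⇒≤m , refl , m-maximal′
      where
      a≰m : ¬ a ≤ m
      a≰m a≤m = w≰m (≤-respʳ-≈ (x≤y⇒y∨x≈y a≤m) w≤m∨a)
      <a⇒≤m : ∀ s → s < a → s ≤ m
      <a⇒≤m s (s≤a , s≉a) = ≤-unless-≤∨ λ w≤m∨s → s≉a (minimal s w≤m∨s s≤a)
      m-maximal′ : ∀ z → a ∧ m ≈ a ∧ z → m ≤ z → z ≈ m
      m-maximal′ z a∧m≈a∧z m≤z = decidable-stable (z ≟ m) λ z≉m →
        a≰m (trans a∧m≈a∧z (≤-trans (≤-trans a≤b b≤w) (decidable-stable (w ≤? z) λ w≰z → z≉m (m-maximal z w≰z m≤z))))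

  rowInjective⇒joinSemidistributive : (∀ x x′ r → IsRow L x r → IsRow L x′ r → x ≈ x′) → JoinSemidistributive L
  rowInjective⇒joinSemidistributive row-injective x y z x∨y≈x∨z =
    decidable-stable ((x ∨ (y ∧ z)) ≟ (x ∨ y)) λ t≉w →
      case maximal-above (λ v≈v′ w≰v w≤v′ → w≰v (≤-respʳ-≈ (sym v≈v′) w≤v′)) (λ v → ¬? (w ≤? v))
                         (λ w≤t → t≉w (≤-antisym (∨-monotonicʳ x∧y≤x) w≤t)) of λ
        (m , t≤m , w≰m , m-maximal) → contradiction w≰m m-maximal t≤m
    where
    w = x ∨ y
    contradiction : ∀ {m} → ¬ w ≤ m → (∀ v → ¬ w ≤ v → m ≤ v → v ≈ m) → x ∨ (y ∧ z) ≤ m → ⊥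
    contradiction {m} w≰m m-maximal t≤m = clash (preimage-below refl) (preimage-below (sym x∨y≈x∨z))
      where
      preimage-below : ∀ {b} → x ∨ b ≈ w → ∃ λ a → a ≤ b × w ≤ m ∨ a × IsRow L a m
      preimage-below {b} x∨b≈w = rowPreimage-below w≰m m-maximal (≤-respʳ-≈ x∨b≈w y≤x∨y)
        (decidable-stable (w ≤? m ∨ b) λ w≰m∨b →
          w≰m (≤-respˡ-≈ x∨b≈w (∨-least (≤-trans x≤x∨y t≤m) (≤-unless-≤∨ w≰m m-maximal w≰m∨b))))
      clash : (∃ λ a → a ≤ y × w ≤ m ∨ a × IsRow L a m) → (∃ λ a′ → a′ ≤ z × w ≤ m ∨ a′ × IsRow L a′ m) → ⊥
      clash (a , a≤y , w≤m∨a , row-a) (a′ , a′≤z , _ , row-a′) = w≰m (≤-respʳ-≈ (x≤y⇒y∨x≈y a≤m) w≤m∨a)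
        where
        a≤y∧z : a ≤ y ∧ z
        a≤y∧z = ∧-greatest a≤y (≤-respˡ-≈ (sym (row-injective a a′ m row-a row-a′)) a′≤z)
        a≤m : a ≤ m
        a≤m = ≤-trans a≤y∧z (≤-trans y≤x∨y t≤m)

module Rowmotion (L : FiniteLattice) (jsd : JoinSemidistributive L) (msd : MeetSemidistributive L) where
  open FiniteLattice L
  open Order L
  open Pop L

  label≰r∨lowerCover : ∀ {x p r y j} → IsPop L x p → p ≈ x ∧ r → y ⋖ x → IsLabel y x j → ¬ j ≤ r ∨ y
  label≰r∨lowerCover pop p≈x∧r y⋖x label@(_ , j≰y , _) j≤r∨y =
    j≰y (meetSemidistributive-cancel msd (label-meet pop p≈x∧r y⋖x label) j≤r∨y)

  x∧≤otherLowerCover : ∀ {x p r y j u y′} → IsPop L x p → p ≈ x ∧ r → y ⋖ x → IsLabel y x j →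
                       u ≤ r ∨ j → y′ ⋖ x → ¬ y′ ≈ y → x ∧ u ≤ y′
  x∧≤otherLowerCover {x} {u = u} {y′} pop p≈x∧r y⋖x label u≤r∨j y′⋖x y′≉y =
    decidable-stable (x ∧ u ≤? y′) λ x∧u≰y′ → case label-exists jsd y′⋖x of λ (j′ , label′) →
      label≰r∨lowerCover pop p≈x∧r y′⋖x label′
        (≤-trans (label≤ label′ x∧u≰y′) (≤-trans u≤r∨j (∨-monotonicʳ (label≤otherLowerCover y⋖x label y′⋖x y′≉y))))

  label≤upperCover : ∀ {x r y j u} → IsRow L x r → y ⋖ x → IsLabel y x j → r ⋖ u → u ≤ r ∨ j → j ≤ u
  label≤upperCover {x} {r} {y} {j} {u} (p , pop , p≈x∧r , r-maximal) y⋖x label ((r≤u , r≉u) , _) u≤r∨j =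
    decidable-stable (j ≤? u) λ j≰u → r≉u (sym (r-maximal u (p≈x∧u j≰u) r≤u))
    where
    x∧u≤lowerCover : ¬ j ≤ u → ∀ y′ → y′ ⋖ x → x ∧ u ≤ y′
    x∧u≤lowerCover j≰u y′ y′⋖x with y′ ≟ y
    ... | yes y′≈y = ≤-respʳ-≈ (sym y′≈y) (decidable-stable (x ∧ u ≤? y) λ x∧u≰y → j≰u (label≤ label x∧u≰y))
    ... | no y′≉y = x∧≤otherLowerCover pop p≈x∧r y⋖x label u≤r∨j y′⋖x y′≉y
    p≈x∧u : ¬ j ≤ u → p ≈ x ∧ u
    p≈x∧u j≰u = ≤-antisym (∧-greatest (pop .proj₁ .proj₁) (≤-trans (x≈y∧z⇒x≤z p≈x∧r) r≤u))
                          (pop .proj₂ (x ∧ u) x∧y≤x (x∧u≤lowerCover j≰u))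

  r<r∨label : ∀ {x p r y j} → IsPop L x p → p ≈ x ∧ r → y ⋖ x → IsLabel y x j → r < r ∨ j
  r<r∨label pop p≈x∧r y⋖x label = x≤x∨y , λ r≈r∨j →
    label≰r∨lowerCover pop p≈x∧r y⋖x label (≤-trans (≤-respʳ-≈ (sym r≈r∨j) y≤x∨y) x≤x∨y)

  row-≤-upperCoverBound : ∀ {x r b} → IsRow L x r → (∀ u → r ⋖ u → u ≤ b) → x ≤ b
  row-≤-upperCoverBound {x} {r} {b} row@(_ , pop , p≈x∧r , _) upperCovers≤b = decidable-stable (x ≤? b) λ x≰b →
    case lowerCover-above (x∧y≤x , λ x∧b≈x → x≰b (≤-respˡ-≈ x∧b≈x x∧y≤y)) of λ (y , y⋖x , x∧b≤y) →
    case label-exists jsd y⋖x of λ (j , label@(j≤x , j≰y , _)) →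
    case upperCover-below (r<r∨label pop p≈x∧r y⋖x label) of λ (u , r⋖u , u≤r∨j) →
    j≰y (≤-trans (∧-greatest j≤x (≤-trans (label≤upperCover row y⋖x label r⋖u u≤r∨j) (upperCovers≤b u r⋖u))) x∧b≤y)

  row-∨-injective : ∀ {x r z} → IsRow L x r → z ≤ x → r ∨ z ≈ r ∨ x → z ≈ x
  row-∨-injective {x} {r} {z} (_ , pop , p≈x∧r , _) z≤x r∨z≈r∨x = decidable-stable (z ≟ x) λ z≉x →
    case lowerCover-above (z≤x , z≉x) of λ (y , y⋖x , z≤y) →
    case label-exists jsd y⋖x of λ (j , label@(j≤x , _)) →
    label≰r∨lowerCover pop p≈x∧r y⋖x label (≤-trans j≤x (≤-trans y≤x∨y (≤-respˡ-≈ r∨z≈r∨x (∨-monotonicʳ z≤y))))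

  row-injective : ∀ x x′ r → IsRow L x r → IsRow L x′ r → x ≈ x′
  row-injective x x′ r row row′ = ≤-antisym (≤-preimage row row′) (≤-preimage row′ row)
    where
    r∨≤r∨ : ∀ {a b} → IsRow L a r → IsRow L b r → r ∨ a ≤ r ∨ b
    r∨≤r∨ row-a row-b = ∨-least x≤x∨y (row-≤-upperCoverBound row-a λ u r⋖u → row-upperCover≤ row-b r⋖u)
    ≤-preimage : ∀ {a b} → IsRow L a r → IsRow L b r → a ≤ b
    ≤-preimage {a} {b} row-a row-b = ≤-respˡ-≈
      (row-∨-injective row-a x∧y≤x (jsd r a b (≤-antisym (r∨≤r∨ row-a row-b) (r∨≤r∨ row-b row-a)))) x∧y≤y

dual : FiniteLattice → FiniteLattice
dual L = record
  { lattice  = LatticeProperties.∧-∨-lattice lattice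
  ; _≟_      = _≟_
  ; elems    = elems
  ; complete = complete
  }
  where open FiniteLattice L

module Duality (L : FiniteLattice) where
  open FiniteLattice L
  open Order L
  private module D = Order (dual L)

  ≥⇒dual-≤ : ∀ {a b} → b ≤ a → a D.≤ b
  ≥⇒dual-≤ b≤a = x≤y⇒y∨x≈y b≤a

  dual-≤⇒≥ : ∀ {a b} → a D.≤ b → b ≤ a
  dual-≤⇒≥ a∨b≈a = ≤-respʳ-≈ a∨b≈a y≤x∨y

  dual-<⇒> : ∀ {a b} → a D.< b → b < a
  dual-<⇒> (a≤ᵈb , a≉b) = dual-≤⇒≥ a≤ᵈb , λ b≈a → a≉b (sym b≈a)

  >⇒dual-< : ∀ {a b} → b < a → a D.< b
  >⇒dual-< (b≤a , b≉a) = ≥⇒dual-≤ b≤a , λ a≈b → b≉a (sym a≈b)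

  ⋖⇒dual-⋖ : ∀ {a b} → b ⋖ a → a D.⋖ b
  ⋖⇒dual-⋖ (b<a , nothing-between) = >⇒dual-< b<a , λ z a<ᵈz z<ᵈb → nothing-between z (dual-<⇒> z<ᵈb) (dual-<⇒> a<ᵈz)

  dual-⋖⇒⋖ : ∀ {a b} → a D.⋖ b → b ⋖ a
  dual-⋖⇒⋖ (a<ᵈb , nothing-between) = dual-<⇒> a<ᵈb , λ z b<z z<a → nothing-between z (>⇒dual-< z<a) (>⇒dual-< b<z)

module Bijectivity (L : FiniteLattice) (jsd : JoinSemidistributive L) (msd : MeetSemidistributive L) where
  open FiniteLattice L
  open Order L
  open Duality L
  open Pop L
  open Rowmotion L jsd msd public using (row-injective)
  private
    module D = Pop (dual L)
    module RowD = Rowmotion (dual L) msd jsd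

  row-function : ∀ x → ∃ λ r → IsRow L x r × (∀ r′ → IsRow L x r′ → r′ ≈ r)
  row-function x = map₂ (λ row → row , λ r′ row′ → row-unique msd row row′) (row-exists x)

  dualRow⇒row : ∀ {r x} → IsRow (dual L) r x → IsRow L x r
  dualRow⇒row {r} {x} dual-row = x ∧ r , ((x∧y≤x , x∧r≤lowerCover) , greatest) , refl , r-maximal
    where
    x∧r≤lowerCover : ∀ y → y ⋖ x → x ∧ r ≤ y
    x∧r≤lowerCover y y⋖x = dual-≤⇒≥ (D.row-upperCover≤ dual-row (⋖⇒dual-⋖ y⋖x))
    greatest : ∀ q → q ≤ x → (∀ y → y ⋖ x → q ≤ y) → q ≤ x ∧ r
    greatest q q≤x q≤lowerCovers =
      ∧-greatest q≤x (dual-≤⇒≥ (RowD.row-≤-upperCoverBound dual-row λ u x⋖ᵈu → ≥⇒dual-≤ (q≤lowerCovers u (dual-⋖⇒⋖ x⋖ᵈu))))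
    r-maximal : ∀ z → x ∧ r ≈ x ∧ z → r ≤ z → z ≈ r
    r-maximal z x∧r≈x∧z r≤z = RowD.row-∨-injective dual-row (≥⇒dual-≤ r≤z) (sym x∧r≈x∧z)

  row-surjective : ∀ r → ∃ λ x → IsRow L x r
  row-surjective r = map₂ dualRow⇒row (D.row-exists r)

proposition9p4 : (L : FiniteLattice) →
    Semidistributive L ⇔ (MeetSemidistributive L × RowBijective L)
proposition9p4 L = mk⇔
  (λ (jsd , msd) → let open Bijectivity L jsd msd in msd , row-function , row-injective , row-surjective)
  (λ (msd , _ , row-injective , _) → Converse.rowInjective⇒joinSemidistributive L row-injective , msd)
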